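{- Let $G,H$ be finite simple connected graphs, fix a root $(r_G,r_H)\in V(G\,\square\,H)$, let $K\in\{G,H\}$ with $\bar K$ the other graph, and write $r_{\bar K}$ for the $\bar K$-coordinate of the root. Let $\alpha\in\{1,\dots,\mathrm{diam}(\bar K)\}$ and let $P$ be a path in $\bar K$ of edge length $\alpha$, $r_{\bar K}=p_0\sim p_1\sim\cdots\sim p_\alpha$. Put $M=2\pi(G)\pi(H)$. Then every configuration $c$ on $G\,\square\,H$ from which no sequence of pebbling moves places a pebble on $(r_G,r_H)$ satisfies \[ 1+\sum_{i=1}^{\alpha}2^{\alpha-i}\bigl(\tilde c_{K,p_i}-|K|\bigr)\ \le\ 2^{\alpha}\bigl(\pi(K)-\tilde c_{K,r_{\bar K}}\bigr)+2^{\alpha}M\Bigl(\alpha-\sum_{i=1}^{\alpha}x_{K,p_i,1}\Bigr). \]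
   Context: The Cartesian product $G\,\square\,H$ has vertex set $V(G)\times V(H)$, with $(g,h)\sim(g',h')$ iff ($g=g'$ and $h\sim_H h'$) or ($h=h'$ and $g\sim_G g'$). $|X|$ is the number of vertices of $X$ and $\mathrm{diam}$ its diameter. A configuration is a function $c:V(G\,\square\,H)\to\mathbb{Z}_{\ge0}$. A pebbling move removes two pebbles from a vertex and adds one to an adjacent vertex. $\pi(X)$ (pebbling number) is the least $k$ such that from every configuration of size $k$ on $X$ and every root some sequence of pebbling moves places a pebble on the root. For $K\in\{G,H\}$, $\bar K$ is the other graph; for $j\in V(\bar K)$ the $K$-slice $K_j$ is $\{(i,j):i\in V(G)\}$ if $K=G$ and $\{(j,h):h\in V(H)\}$ if $K=H$. For a configuration $c$: $\tilde c_{K,j}=\sum_{u\in K_j}c(u)$; $set_{K,j}=\lfloor\tilde c_{K,j}/\pi(K)\rfloor$; $extra_{K,j}=\tilde c_{K,j}-\pi(K)\,set_{K,j}$; $sat_{K,j}=\lfloor(\tilde c_{K,j}-extra_{K,j})/|K|\rfloor$; $x_{K,j,t}=1$ if $sat_{K,j}\ge t$ and $0$ otherwise. -}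

module Defs where

open import Data.Nat using (ℕ; zero; suc; _+_; _*_; _∸_; _^_; _≤_; _<_; _≤?_)
open import Data.Nat.DivMod using (_/_)
open import Data.Integer as ℤ using (ℤ; +_)
open import Data.Fin using (Fin; zero; suc; toℕ; inject₁)
open import Data.Bool using (Bool; T)
open import Data.Product using (Σ; ∃; ∃-syntax; _×_; _,_)
open import Data.Sum using (_⊎_)
open import Function using (_∘_; Injective)
open import Relation.Nullary using (¬_; yes; no)
open import Relation.Binary.PropositionalEquality using (_≡_; _≢_)
open import Relation.Binary.Construct.Closure.ReflexiveTransitive using (Star)

sumFin : (n : ℕ) → (Fin n → ℕ) → ℕ
sumFin zero    f = 0
sumFin (suc n) f = f zero + sumFin n (f ∘ suc)

sumFinℤ : (n : ℕ) → (Fin n → ℤ) → ℤ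
sumFinℤ zero    f = + 0
sumFinℤ (suc n) f = f zero ℤ.+ sumFinℤ n (f ∘ suc)

-- floor division, total (value irrelevant when the divisor is 0;
-- in the theorem divisors are π(K) ≥ 1 and |K| ≥ 1)
_div_ : ℕ → ℕ → ℕ
a div zero    = 0
a div (suc b) = a / suc b

record Graph (n : ℕ) : Set where
  field
    adj    : Fin n → Fin n → Bool
    sym    : ∀ u v → T (adj u v) → T (adj v u)
    irrefl : ∀ u → ¬ T (adj u u)

  Adj : Fin n → Fin n → Set
  Adj u v = T (adj u v)

open Graph public using (Adj)

data Walk {n} (G : Graph n) : Fin n → Fin n → ℕ → Set where
  [] : ∀ {u} → Walk G u u 0
  _∷_ : ∀ {u v w ℓ} → Adj G u v → Walk G v w ℓ → Walk G u w (suc ℓ)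

Connected : ∀ {n} → Graph n → Set
Connected {n} G = ∀ (u v : Fin n) → ∃[ ℓ ] Walk G u v ℓ

IsDiam : ∀ {n} → Graph n → ℕ → Set
IsDiam {n} G D =
  (∀ (u v : Fin n) → ∃[ ℓ ] (ℓ ≤ D × Walk G u v ℓ)) ×
  (∃[ u ] ∃[ v ] (∀ ℓ → Walk G u v ℓ → D ≤ ℓ))

IsPath : ∀ {n} → Graph n → (α : ℕ) → (Fin (suc α) → Fin n) → Set
IsPath G α p = (∀ (i : Fin α) → Adj G (p (inject₁ i)) (p (suc i))) × Injective _≡_ _≡_ p

module _ {V : Set} (A : V → V → Set) where

  data Move (c c' : V → ℕ) : Set where
    move : (u v : V) → A u v →
           c u ≡ c' u + 2 → c' v ≡ c v + 1 →
           (∀ w → w ≢ u → w ≢ v → c' w ≡ c w) → Move c c'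

  Solvable : (V → ℕ) → V → Set
  Solvable c r = ∃[ c' ] (Star Move c c' × 1 ≤ c' r)

AllSolvable : ∀ {n} → Graph n → ℕ → Set
AllSolvable {n} G k = ∀ (c : Fin n → ℕ) (r : Fin n) → sumFin n c ≡ k → Solvable (Adj G) c r

IsPebblingNumber : ∀ {n} → Graph n → ℕ → Set
IsPebblingNumber G k = AllSolvable G k × (∀ k' → k' < k → ¬ AllSolvable G k')

ProdAdj : ∀ {m n} → Graph m → Graph n → (Fin m × Fin n) → (Fin m × Fin n) → Set
ProdAdj G H (g , h) (g' , h') = (g ≡ g' × Adj H h h') ⊎ (h ≡ h' × Adj G g g')

sizeProd : (m n : ℕ) → (Fin m × Fin n → ℕ) → ℕ
sizeProd m n c = sumFin m (λ i → sumFin n (λ j → c (i , j)))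

sliceG : (m n : ℕ) → (Fin m × Fin n → ℕ) → Fin n → ℕ
sliceG m n c j = sumFin m (λ i → c (i , j))

sliceH : (m n : ℕ) → (Fin m × Fin n → ℕ) → Fin m → ℕ
sliceH m n c j = sumFin n (λ h → c (j , h))

-- set / extra / sat / x, given |K| = nK, π(K) = πK and a slice-sum value t = c̃_{K,j}

setK : (πK t : ℕ) → ℕ
setK πK t = t div πK

extraK : (πK t : ℕ) → ℕ
extraK πK t = t ∸ πK * setK πK t

satK : (nK πK t : ℕ) → ℕ
satK nK πK t = (t ∸ extraK πK t) div nK

xK : (nK πK t tt : ℕ) → ℕ
xK nK πK t tt with tt ≤? satK nK πK t
... | yes _ = 1
... | no  _ = 0

-- The inequality of Theorem 9 for a fixed K, given:
--   nK = |K|, πK = π(K), M, the other graph K̄ (on Fin nb) with diameter D,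
--   the slice sums c̃_{K,·} : V(K̄) → ℕ, and r = r_{K̄}.

SliceBound : (nK πK M : ℕ) → ∀ {nb} → Graph nb → (D : ℕ) → (Fin nb → ℕ) → Fin nb → Set
SliceBound nK πK M {nb} Kb D ct r =
  ∀ (α : ℕ) → 1 ≤ α → α ≤ D →
  ∀ (p : Fin (suc α) → Fin nb) → IsPath Kb α p → p zero ≡ r →
  (+ 1 ℤ.+ sumFinℤ α (λ i → + (2 ^ (α ∸ suc (toℕ i))) ℤ.* (+ ct (p (suc i)) ℤ.- + nK)))
  ℤ.≤
  (+ (2 ^ α) ℤ.* (+ πK ℤ.- + ct r)
   ℤ.+ + (2 ^ α * M) ℤ.* (+ α ℤ.- + sumFin α (λ i → xK nK πK (ct (p (suc i))) 1)))

-- Write t_j for the number of pebbles on the K-slice at j ∈ V(K̄). Along an edge u ∼ v of K̄,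
-- repeatedly moving pebbles from (g , u) to (g , v) keeps 2 t_v + t_u fixed and stops only
-- when every vertex of the u-slice holds at most one pebble, so a reachable configuration c'
-- has 2 t_v + t_u ≤ 2 t'_v + |K|. Sweeping the path from its far end into p₀ = r gives a
-- reachable c' with Σ_{i ≤ α} 2^(α−i) t_{p_i} + |K| ≤ 2^α (t'_r + |K|), and t'_r < π(K),
-- since otherwise π(K) of the pebbles on the root slice already reach the root inside that
-- copy of K. Rearranging gives the inequality even without the nonnegative x-term.

module Submission where

open import Defs
open import Data.Nat using (ℕ; zero; suc; _+_; _*_; _∸_; _^_; _⊓_; _≤_; _<_; z≤n; _≤?_)
open import Data.Nat.Properties
open import Data.Nat.Induction using (<-wellFounded)
open import Data.Nat.Tactic.RingSolver using (solve-∀)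
open import Algebra.Properties.CommutativeSemigroup +-commutativeSemigroup using (xy∙z≈xz∙y; xy∙z≈zy∙x)
open import Data.Integer as ℤ using (ℤ)
import Data.Integer.Properties as ℤ
import Data.Integer.Tactic.RingSolver as ℤ
open import Data.Fin using (Fin; zero; suc; toℕ)
import Data.Fin.Properties as Fin
open import Data.Fin.Properties using (any?)
import Data.Vec.Functional as Vector
open import Data.Product using (∃-syntax; _×_; _,_; proj₁; proj₂; swap)
open import Data.Product.Properties using (≡-dec)
open import Data.Sum as Sum using (inj₁; inj₂)
open import Data.Empty using (⊥-elim)
open import Function using (_∘_)
open import Induction.WellFounded using (Acc; acc)
open import Relation.Binary.Definitions using (DecidableEquality)
open import Relation.Binary.PropositionalEquality
open import Relation.Binary.Construct.Closure.ReflexiveTransitive using (Star; ε; _◅_; _◅◅_; gmap)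
open import Relation.Nullary using (¬_; yes; no)

sumFin-cong : ∀ k {f g : Fin k → ℕ} → (∀ i → f i ≡ g i) → sumFin k f ≡ sumFin k g
sumFin-cong zero    f≗g = refl
sumFin-cong (suc k) f≗g = cong₂ _+_ (f≗g zero) (sumFin-cong k (f≗g ∘ suc))

sumFin-≤-card : ∀ k (f : Fin k → ℕ) → (∀ i → f i ≤ 1) → sumFin k f ≤ k
sumFin-≤-card zero    f f≤1 = z≤n
sumFin-≤-card (suc k) f f≤1 = +-mono-≤ (f≤1 zero) (sumFin-≤-card k (f ∘ suc) (f≤1 ∘ suc))

sumFin-update : ∀ k (f f' : Fin k → ℕ) j → (∀ i → i ≢ j → f' i ≡ f i) →
                sumFin k f' + f j ≡ sumFin k f + f' j
sumFin-update (suc k) f f' zero    f'≗f = begin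
  f' zero + sumFin k (f' ∘ suc) + f zero
    ≡⟨ cong (λ s → f' zero + s + f zero) (sumFin-cong k (λ i → f'≗f (suc i) λ ())) ⟩
  f' zero + sumFin k (f ∘ suc) + f zero
    ≡⟨ xy∙z≈zy∙x (f' zero) _ (f zero) ⟩
  f zero + sumFin k (f ∘ suc) + f' zero
    ∎
  where open ≡-Reasoning
sumFin-update (suc k) f f' (suc j) f'≗f = begin
  f' zero + sumFin k (f' ∘ suc) + f (suc j)   ≡⟨ +-assoc (f' zero) _ _ ⟩
  f' zero + (sumFin k (f' ∘ suc) + f (suc j)) ≡⟨ cong₂ _+_ (f'≗f zero λ ()) IH ⟩
  f zero + (sumFin k (f ∘ suc) + f' (suc j))  ≡⟨ +-assoc (f zero) _ _ ⟨
  f zero + sumFin k (f ∘ suc) + f' (suc j)    ∎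
  where
  open ≡-Reasoning
  IH : sumFin k (f' ∘ suc) + f (suc j) ≡ sumFin k (f ∘ suc) + f' (suc j)
  IH = sumFin-update k (f ∘ suc) (f' ∘ suc) j (λ i i≢j → f'≗f (suc i) (i≢j ∘ Fin.suc-injective))

sumFin-shrink : ∀ k (f : Fin k → ℕ) {t} → t ≤ sumFin k f →
                ∃[ f' ] ((∀ i → f' i ≤ f i) × sumFin k f' ≡ t)
sumFin-shrink zero    f z≤n = f , (λ _ → ≤-refl) , refl
sumFin-shrink (suc k) f {t} t≤Σf =
  let f' , f'≤f , Σf' = sumFin-shrink k (f ∘ suc) rest≤
  in (f zero ⊓ t) Vector.∷ f'
   , (λ { zero → m⊓n≤m (f zero) t ; (suc i) → f'≤f i })
   , trans (cong ((f zero ⊓ t) +_) Σf') (m⊓n+n∸m≡n (f zero) t)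
  where
  rest≤ : t ∸ f zero ≤ sumFin k (f ∘ suc)
  rest≤ = ≤-trans (∸-monoˡ-≤ (f zero) t≤Σf) (≤-reflexive (m+n∸m≡n (f zero) _))

module _ {V : Set} (A : V → V → Set) where

  Solvable-◅◅ : ∀ {c c' r} → Star (Move A) c c' → Solvable A c' r → Solvable A c r
  Solvable-◅◅ c↝c' (d , c'↝d , 1≤d) = d , c↝c' ◅◅ c'↝d , 1≤d

  Move-+ : ∀ (e : V → ℕ) {c c'} → Move A c c' → Move A (λ x → c x + e x) (λ x → c' x + e x)
  Move-+ e (move u v u~v cu cv rest) =
    move u v u~v (trans (cong (_+ e u) cu) (xy∙z≈xz∙y _ 2 (e u)))
                 (trans (cong (_+ e v) cv) (xy∙z≈xz∙y _ 1 (e v)))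
                 (λ w w≢u w≢v → cong (_+ e w) (rest w w≢u w≢v))

  Move-≗ˡ : ∀ {c d c'} → (∀ x → c x ≡ d x) → Move A c c' → Move A d c'
  Move-≗ˡ c≗d (move u v u~v cu cv rest) =
    move u v u~v (trans (sym (c≗d u)) cu) (trans cv (cong (_+ 1) (c≗d v)))
                 (λ w w≢u w≢v → trans (rest w w≢u w≢v) (c≗d w))

  Solvable-≗ : ∀ {c d r} → (∀ x → c x ≡ d x) → Solvable A c r → Solvable A d r
  Solvable-≗ c≗d (_ , ε ,          1≤c) = _ , ε , subst (1 ≤_) (c≗d _) 1≤c
  Solvable-≗ c≗d (e , mv ◅ c'↝e , 1≤e) = e , Move-≗ˡ c≗d mv ◅ c'↝e , 1≤e

  Solvable-mono : ∀ {c d r} → (∀ x → c x ≤ d x) → Solvable A c r → Solvable A d r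
  Solvable-mono {c} {d} c≤d (c' , c↝c' , 1≤c') =
    Solvable-≗ (λ x → m+[n∸m]≡n (c≤d x))
      ( (λ x → c' x + (d x ∸ c x))
      , gmap _ (Move-+ (λ x → d x ∸ c x)) c↝c'
      , ≤-trans 1≤c' (m≤m+n _ _))

module _ {V : Set} (_≟_ : DecidableEquality V) where

  fire : (V → ℕ) → V → V → V → ℕ
  fire c a b x with x ≟ a | x ≟ b
  ... | yes _ | _     = c x ∸ 2
  ... | no  _ | yes _ = suc (c x)
  ... | no  _ | no  _ = c x

  fire-source : ∀ c a b → fire c a b a ≡ c a ∸ 2
  fire-source c a b with a ≟ a | a ≟ b
  ... | yes _   | _ = refl
  ... | no  a≢a | _ = ⊥-elim (a≢a refl)

  fire-target : ∀ c {a b} → a ≢ b → fire c a b b ≡ suc (c b)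
  fire-target c {a} {b} a≢b with b ≟ a | b ≟ b
  ... | yes b≡a | _       = ⊥-elim (a≢b (sym b≡a))
  ... | no  _   | yes _   = refl
  ... | no  _   | no  b≢b = ⊥-elim (b≢b refl)

  fire-other : ∀ c {a b x} → x ≢ a → x ≢ b → fire c a b x ≡ c x
  fire-other c {a} {b} {x} x≢a x≢b with x ≟ a | x ≟ b
  ... | yes x≡a | _       = ⊥-elim (x≢a x≡a)
  ... | no  _   | yes x≡b = ⊥-elim (x≢b x≡b)
  ... | no  _   | no  _   = refl

  Move-fire : ∀ (A : V → V → Set) c {a b} → A a b → a ≢ b → 2 ≤ c a → Move A c (fire c a b)
  Move-fire A c {a} {b} a~b a≢b 2≤ca =
    move a b a~b (trans (sym (m∸n+n≡m 2≤ca)) (cong (_+ 2) (sym (fire-source c a b))))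
                 (trans (fire-target c a≢b) (+-comm 1 (c b)))
                 (λ w → fire-other c)

weightedSum : ∀ k → (Fin (suc k) → ℕ) → ℕ
weightedSum k f = sumFin (suc k) (λ i → 2 ^ (k ∸ toℕ i) * f i)

geometric-sum : ∀ α → suc (sumFin α (λ i → 2 ^ (α ∸ suc (toℕ i)))) ≡ 2 ^ α
geometric-sum zero    = refl
geometric-sum (suc α) = begin
  suc (2 ^ α + sumFin α (λ i → 2 ^ (α ∸ suc (toℕ i)))) ≡⟨ +-suc (2 ^ α) _ ⟨
  2 ^ α + suc (sumFin α (λ i → 2 ^ (α ∸ suc (toℕ i)))) ≡⟨ cong (2 ^ α +_) (geometric-sum α) ⟩
  2 ^ α + 2 ^ α                                         ≡⟨ cong (2 ^ α +_) (+-identityʳ (2 ^ α)) ⟨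
  2 * 2 ^ α                                             ∎
  where open ≡-Reasoning

IsPath-tail : ∀ {n k} (K : Graph n) {q : Fin (suc (suc k)) → Fin n} →
              IsPath K (suc k) q → IsPath K k (q ∘ suc)
IsPath-tail K (edge , injective) = edge ∘ suc , Fin.suc-injective ∘ injective

module Product {m n} (G : Graph m) (H : Graph n) where

  V : Set
  V = Fin m × Fin n

  A : V → V → Set
  A = ProdAdj G H

  _≟ᵥ_ : DecidableEquality V
  _≟ᵥ_ = ≡-dec Fin._≟_ Fin._≟_

  slice : (V → ℕ) → Fin n → ℕ
  slice = sliceG m n

  inRow : Fin n → (Fin m → ℕ) → V → ℕ
  inRow h f (g , h') with h' Fin.≟ h
  ... | yes _ = f g
  ... | no  _ = 0

  inRow-diag : ∀ h f g → inRow h f (g , h) ≡ f g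
  inRow-diag h f g with h Fin.≟ h
  ... | yes _   = refl
  ... | no  h≢h = ⊥-elim (h≢h refl)

  inRow-≤ : ∀ h {f} (c : V → ℕ) → (∀ g → f g ≤ c (g , h)) → ∀ x → inRow h f x ≤ c x
  inRow-≤ h c f≤c (g , h') with h' Fin.≟ h
  ... | yes refl = f≤c g
  ... | no  _    = z≤n

  Move-inRow : ∀ h {f f'} → Move (Adj G) f f' → Move A (inRow h f) (inRow h f')
  Move-inRow h {f} {f'} (move u v u~v fu f'v rest) =
    move (u , h) (v , h) (inj₂ (refl , u~v))
      (trans (inRow-diag h f u) (trans fu (cong (_+ 2) (sym (inRow-diag h f' u)))))
      (trans (inRow-diag h f' v) (trans f'v (cong (_+ 1) (sym (inRow-diag h f v)))))
      off-move
    where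
    off-move : ∀ x → x ≢ (u , h) → x ≢ (v , h) → inRow h f' x ≡ inRow h f x
    off-move (g , h') x≢u x≢v with h' Fin.≟ h
    ... | yes refl = rest g (x≢u ∘ cong (_, h)) (x≢v ∘ cong (_, h))
    ... | no  _    = refl

  Solvable-inRow : ∀ h {f r} → Solvable (Adj G) f r → Solvable A (inRow h f) (r , h)
  Solvable-inRow h {r = r} (d , f↝d , 1≤d) =
    inRow h d , gmap (inRow h) (Move-inRow h) f↝d , subst (1 ≤_) (sym (inRow-diag h d r)) 1≤d

  slice-<-π : ∀ {π} → AllSolvable G π → ∀ {c r h} → ¬ Solvable A c (r , h) → slice c h < π
  slice-<-π {π} solvable {c} {r} {h} unsolvable with π ≤? slice c h
  ... | no  π≰ = ≰⇒> π≰
  ... | yes π≤ =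
    let f , f≤c , Σf = sumFin-shrink m (λ g → c (g , h)) π≤
    in ⊥-elim (unsolvable (Solvable-mono A (inRow-≤ h c f≤c) (Solvable-inRow h (solvable f r Σf))))

  module Transfer {u v : Fin n} (u~v : Adj H u v) where

    u≢v : u ≢ v
    u≢v refl = Graph.irrefl H u u~v

    shift : (V → ℕ) → Fin m → V → ℕ
    shift c g = fire _≟ᵥ_ c (g , u) (g , v)

    shift-off-column : ∀ c {g i} w → i ≢ g → shift c g (i , w) ≡ c (i , w)
    shift-off-column c w i≢g = fire-other _≟ᵥ_ c (i≢g ∘ cong proj₁) (i≢g ∘ cong proj₁)

    slice-shift-source : ∀ c {g} → 2 ≤ c (g , u) → slice (shift c g) u + 2 ≡ slice c u
    slice-shift-source c {g} 2≤c = +-cancelʳ-≡ (c (g , u) ∸ 2) _ _ (begin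
      slice (shift c g) u + 2 + (c (g , u) ∸ 2)   ≡⟨ +-assoc (slice (shift c g) u) 2 _ ⟩
      slice (shift c g) u + (2 + (c (g , u) ∸ 2)) ≡⟨ cong (slice (shift c g) u +_) (m+[n∸m]≡n 2≤c) ⟩
      slice (shift c g) u + c (g , u)             ≡⟨ sumFin-update m _ _ g (λ i → shift-off-column c u) ⟩
      slice c u + shift c g (g , u)               ≡⟨ cong (slice c u +_) (fire-source _≟ᵥ_ c _ _) ⟩
      slice c u + (c (g , u) ∸ 2)                 ∎)
      where open ≡-Reasoning

    slice-shift-target : ∀ c {g} → slice (shift c g) v ≡ suc (slice c v)
    slice-shift-target c {g} = +-cancelʳ-≡ (c (g , v)) _ _ (begin
      slice (shift c g) v + c (g , v)  ≡⟨ sumFin-update m _ _ g (λ i → shift-off-column c v) ⟩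
      slice c v + shift c g (g , v)    ≡⟨ cong (slice c v +_) (fire-target _≟ᵥ_ c (u≢v ∘ cong proj₂)) ⟩
      slice c v + suc (c (g , v))      ≡⟨ +-suc (slice c v) _ ⟩
      suc (slice c v) + c (g , v)      ∎)
      where open ≡-Reasoning

    slice-shift-other : ∀ c {g w} → w ≢ u → w ≢ v → slice (shift c g) w ≡ slice c w
    slice-shift-other c w≢u w≢v =
      sumFin-cong m (λ i → fire-other _≟ᵥ_ c (w≢u ∘ cong proj₂) (w≢v ∘ cong proj₂))

    shift-preserves-potential : ∀ c {g} → 2 ≤ c (g , u) →
      2 * slice c v + slice c u ≡ 2 * slice (shift c g) v + slice (shift c g) u
    shift-preserves-potential c {g} 2≤c = begin
      2 * slice c v + slice c u
        ≡⟨ cong (2 * slice c v +_) (slice-shift-source c 2≤c) ⟨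
      2 * slice c v + (slice (shift c g) u + 2)
        ≡⟨ regroup (slice c v) _ ⟩
      2 * suc (slice c v) + slice (shift c g) u
        ≡⟨ cong (λ s → 2 * s + slice (shift c g) u) (slice-shift-target c) ⟨
      2 * slice (shift c g) v + slice (shift c g) u
        ∎
      where
      open ≡-Reasoning
      regroup : ∀ a b → 2 * a + (b + 2) ≡ 2 * (1 + a) + b
      regroup = solve-∀

    transfer : ∀ c → Acc _<_ (slice c u) →
               ∃[ c' ] (Star (Move A) c c'
                        × 2 * slice c v + slice c u ≤ 2 * slice c' v + m
                        × (∀ w → w ≢ u → w ≢ v → slice c' w ≡ slice c w))
    transfer c (acc smaller) with any? (λ g → 2 ≤? c (g , u))
    ... | no ∄g = c , ε , +-monoʳ-≤ (2 * slice c v) (sumFin-≤-card m _ at-most-one) , λ _ _ _ → refl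
      where
      at-most-one : ∀ g → c (g , u) ≤ 1
      at-most-one g = ≤-pred (≰⇒> (λ 2≤c → ∄g (g , 2≤c)))
    ... | yes (g , 2≤c) =
      let c' , shift↝c' , bound , frame = transfer (shift c g) (smaller shift-<)
      in c' , Move-fire _≟ᵥ_ A c (inj₁ (refl , u~v)) (u≢v ∘ cong proj₂) 2≤c ◅ shift↝c'
            , ≤-trans (≤-reflexive (shift-preserves-potential c 2≤c)) bound
            , λ w w≢u w≢v → trans (frame w w≢u w≢v) (slice-shift-other c w≢u w≢v)
      where
      shift-< : slice (shift c g) u < slice c u
      shift-< = ≤-trans (m<m+n _ 0<1+n) (≤-reflexive (slice-shift-source c 2≤c))

  open Transfer using (transfer)

  collect : ∀ k (q : Fin (suc k) → Fin n) → IsPath H k q → ∀ c →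
            ∃[ c' ] (Star (Move A) c c'
                     × weightedSum k (slice c ∘ q) + m ≤ 2 ^ k * (slice c' (q zero) + m)
                     × (∀ w → (∀ i → q i ≢ w) → slice c' w ≡ slice c w))
  collect zero q _ c = c , ε , ≤-reflexive (regroup (slice c (q zero)) m) , λ _ _ → refl
    where
    regroup : ∀ a b → 1 * a + 0 + b ≡ 1 * (a + b)
    regroup = solve-∀
  collect (suc k) q path@(edge , injective) c =
    let c₁ , c↝c₁ , tail-bound , tail-frame = collect k (q ∘ suc) (IsPath-tail H path) c
        c₂ , c₁↝c₂ , edge-bound , edge-frame =
          transfer (Graph.sym H _ _ (edge zero)) c₁ (<-wellFounded (slice c₁ (q (suc zero))))
        start-kept : slice c₁ (q zero) ≡ slice c (q zero)
        start-kept = tail-frame (q zero) (λ i q₁₊ᵢ≡q₀ → Fin.0≢1+n (injective (sym q₁₊ᵢ≡q₀)))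
    in c₂ , c↝c₁ ◅◅ c₁↝c₂
     , horner-step (2 ^ k) start-kept edge-bound tail-bound
     , λ w w∉q → trans (edge-frame w (λ w≡q₁ → w∉q (suc zero) (sym w≡q₁))
                                      (λ w≡q₀ → w∉q zero (sym w≡q₀)))
                       (tail-frame w (w∉q ∘ suc))
    where
    horner-step : ∀ P {a₁ a b a₂ W} → a₁ ≡ a → 2 * a₁ + b ≤ 2 * a₂ + m → W + m ≤ P * (b + m) →
                  2 * P * a + W + m ≤ 2 * P * (a₂ + m)
    horner-step P {a₁} {a} {b} {a₂} {W} a₁≡a edge tail = begin
      2 * P * a + W + m        ≡⟨ +-assoc (2 * P * a) W m ⟩
      2 * P * a + (W + m)      ≤⟨ +-monoʳ-≤ (2 * P * a) tail ⟩
      2 * P * a + P * (b + m)  ≡⟨ factor P a b m ⟩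
      P * (2 * a + b + m)      ≡⟨ cong (λ s → P * (2 * s + b + m)) a₁≡a ⟨
      P * (2 * a₁ + b + m)     ≤⟨ *-monoʳ-≤ P (+-monoˡ-≤ m edge) ⟩
      P * (2 * a₂ + m + m)     ≡⟨ unfactor P a₂ m ⟩
      2 * P * (a₂ + m)         ∎
      where
      open ≤-Reasoning
      factor : ∀ P a b m → 2 * P * a + P * (b + m) ≡ P * (2 * a + b + m)
      factor = solve-∀
      unfactor : ∀ P a m → P * (2 * a + m + m) ≡ 2 * P * (a + m)
      unfactor = solve-∀

  weightedSum-< : ∀ {π} → AllSolvable G π → ∀ {c r h} → ¬ Solvable A c (r , h) →
                  ∀ α p → IsPath H α p → p zero ≡ h →
                  weightedSum α (slice c ∘ p) + m < 2 ^ α * (π + m)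
  weightedSum-< {π} solvable {c} {r} {h} unsolvable α p path p₀≡h =
    let c' , c↝c' , bound , _ = collect α p path c
        root< : slice c' h < π
        root< = slice-<-π solvable (unsolvable ∘ Solvable-◅◅ A c↝c')
    in begin-strict
         weightedSum α (slice c ∘ p) + m  ≤⟨ bound ⟩
         2 ^ α * (slice c' (p zero) + m) ≡⟨ cong (λ x → 2 ^ α * (slice c' x + m)) p₀≡h ⟩
         2 ^ α * (slice c' h + m)        <⟨ *-monoʳ-< (2 ^ α) {{m^n≢0 2 α}} (+-monoˡ-< m root<) ⟩
         2 ^ α * (π + m)                 ∎
    where open ≤-Reasoning

-- Opened only here: with +_ in scope, ℕ sections such as (a +_) become ambiguous.
open import Data.Integer using (+_; +≤+)

sumFinℤ-weighted-offset : ∀ k (w a : Fin k → ℕ) b →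
  sumFinℤ k (λ i → + w i ℤ.* (+ a i ℤ.- + b))
  ≡ + sumFin k (λ i → w i * a i) ℤ.- + b ℤ.* + sumFin k w
sumFinℤ-weighted-offset zero    w a b = sym (cong (ℤ._-_ (+ 0)) (ℤ.*-zeroʳ (+ b)))
sumFinℤ-weighted-offset (suc k) w a b = begin
  + w zero ℤ.* (+ a zero ℤ.- + b) ℤ.+ sumFinℤ k (λ i → + w (suc i) ℤ.* (+ a (suc i) ℤ.- + b))
    ≡⟨ cong (ℤ._+_ (+ w zero ℤ.* (+ a zero ℤ.- + b)))
            (sumFinℤ-weighted-offset k (w ∘ suc) (a ∘ suc) b) ⟩
  + w zero ℤ.* (+ a zero ℤ.- + b) ℤ.+ (+ S ℤ.- + b ℤ.* + W)
    ≡⟨ distribute (+ w zero) (+ a zero) (+ b) (+ S) (+ W) ⟩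
  + w zero ℤ.* + a zero ℤ.+ + S ℤ.- + b ℤ.* (+ w zero ℤ.+ + W)
    ≡⟨ cong (λ x → x ℤ.+ + S ℤ.- + b ℤ.* (+ w zero ℤ.+ + W)) (ℤ.pos-* (w zero) (a zero)) ⟨
  + (w zero * a zero + S) ℤ.- + b ℤ.* + (w zero + W)
    ∎
  where
  open ≡-Reasoning
  S W : ℕ
  S = sumFin k (λ i → w (suc i) * a (suc i))
  W = sumFin k (w ∘ suc)
  distribute : ∀ w a b S W →
               w ℤ.* (a ℤ.- b) ℤ.+ (S ℤ.- b ℤ.* W) ≡ w ℤ.* a ℤ.+ S ℤ.- b ℤ.* (w ℤ.+ W)
  distribute = ℤ.solve-∀

deviation-bound : ∀ {P G π s₀ S m} → suc G ≡ P → P * s₀ + S + m < P * (π + m) →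
                  + 1 ℤ.+ (+ S ℤ.- + m ℤ.* + G) ℤ.≤ + P ℤ.* (+ π ℤ.- + s₀)
deviation-bound {_} {G} {π} {s₀} {S} {m} refl bound = begin
  + 1 ℤ.+ (+ S ℤ.- + m ℤ.* + G)                    ≡⟨ shift-left (+ G) (+ s₀) (+ S) (+ m) ⟩
  + 1 ℤ.+ (+ suc G ℤ.* + s₀ ℤ.+ + S ℤ.+ + m) ℤ.- D  ≤⟨ ℤ.+-monoˡ-≤ (ℤ.- D) boundℤ ⟩
  + suc G ℤ.* (+ π ℤ.+ + m) ℤ.- D                  ≡⟨ shift-right (+ G) (+ s₀) (+ π) (+ m) ⟩
  + suc G ℤ.* (+ π ℤ.- + s₀)                        ∎
  where
  open ℤ.≤-Reasoning
  D : ℤ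
  D = + suc G ℤ.* + s₀ ℤ.+ + m ℤ.* + suc G
  boundℤ : + 1 ℤ.+ (+ suc G ℤ.* + s₀ ℤ.+ + S ℤ.+ + m) ℤ.≤ + suc G ℤ.* (+ π ℤ.+ + m)
  boundℤ = subst₂ (λ x y → + 1 ℤ.+ (x ℤ.+ + S ℤ.+ + m) ℤ.≤ y)
             (ℤ.pos-* (suc G) s₀) (ℤ.pos-* (suc G) (π + m)) (+≤+ bound)
  shift-left : ∀ g s₀ S m →
               + 1 ℤ.+ (S ℤ.- m ℤ.* g)
             ≡ + 1 ℤ.+ ((+ 1 ℤ.+ g) ℤ.* s₀ ℤ.+ S ℤ.+ m)
               ℤ.- ((+ 1 ℤ.+ g) ℤ.* s₀ ℤ.+ m ℤ.* (+ 1 ℤ.+ g))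
  shift-left = ℤ.solve-∀
  shift-right : ∀ g s₀ π m →
                (+ 1 ℤ.+ g) ℤ.* (π ℤ.+ m) ℤ.- ((+ 1 ℤ.+ g) ℤ.* s₀ ℤ.+ m ℤ.* (+ 1 ℤ.+ g))
              ≡ (+ 1 ℤ.+ g) ℤ.* (π ℤ.- s₀)
  shift-right = ℤ.solve-∀

xK-≤1 : ∀ nK πK t tt → xK nK πK t tt ≤ 1
xK-≤1 nK πK t tt with tt ≤? satK nK πK t
... | yes _ = ≤-refl
... | no  _ = z≤n

sliceBound : ∀ {nK πK M nb} (K̄ : Graph nb) D (ct : Fin nb → ℕ) r →
             (∀ α p → IsPath K̄ α p → p zero ≡ r →
                      weightedSum α (ct ∘ p) + nK < 2 ^ α * (πK + nK)) →
             SliceBound nK πK M K̄ D ct r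
sliceBound {nK} {πK} {M} K̄ D ct .(p zero) weighted< α _ _ p path refl = begin
  + 1 ℤ.+ sumFinℤ α (λ i → + w i ℤ.* (+ ct (p (suc i)) ℤ.- + nK))
    ≡⟨ cong (ℤ._+_ (+ 1)) (sumFinℤ-weighted-offset α w (ct ∘ p ∘ suc) nK) ⟩
  + 1 ℤ.+ (+ sumFin α (λ i → w i * ct (p (suc i))) ℤ.- + nK ℤ.* + sumFin α w)
    ≤⟨ deviation-bound (geometric-sum α) (weighted< α p path refl) ⟩
  Y
    ≤⟨ ℤ.i≤i+j Y (+ (2 ^ α * M * (α ∸ X))) ⟩
  Y ℤ.+ + (2 ^ α * M * (α ∸ X))
    ≡⟨ cong (ℤ._+_ Y) surplus ⟩
  Y ℤ.+ + (2 ^ α * M) ℤ.* (+ α ℤ.- + X)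
    ∎
  where
  open ℤ.≤-Reasoning
  w : Fin α → ℕ
  w i = 2 ^ (α ∸ suc (toℕ i))
  X : ℕ
  X = sumFin α (λ i → xK nK πK (ct (p (suc i))) 1)
  Y : ℤ
  Y = + (2 ^ α) ℤ.* (+ πK ℤ.- + ct (p zero))
  surplus : + (2 ^ α * M * (α ∸ X)) ≡ + (2 ^ α * M) ℤ.* (+ α ℤ.- + X)
  surplus = trans (ℤ.pos-* (2 ^ α * M) _) (cong (ℤ._*_ (+ (2 ^ α * M)))
              (sym (trans (ℤ.m-n≡m⊖n α X) (ℤ.⊖-≥ X≤α))))
    where
    X≤α : X ≤ α
    X≤α = sumFin-≤-card α _ (λ i → xK-≤1 _ _ _ _)

Solvable-swap : ∀ {m n} (G : Graph m) (H : Graph n) {c g h} →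
                Solvable (ProdAdj H G) (c ∘ swap) (h , g) → Solvable (ProdAdj G H) c (g , h)
Solvable-swap G H (d , c↝d , 1≤d) = d ∘ swap , gmap (_∘ swap) Move-swap c↝d , 1≤d
  where
  Move-swap : ∀ {d d'} → Move (ProdAdj H G) d d' → Move (ProdAdj G H) (d ∘ swap) (d' ∘ swap)
  Move-swap (move u v u~v du d'v rest) =
    move (swap u) (swap v) (Sum.swap u~v) du d'v
         (λ w w≢u w≢v → rest (swap w) (w≢u ∘ cong swap) (w≢v ∘ cong swap))

theorem9 : ∀ {m n} (G : Graph m) (H : Graph n) → Connected G → Connected H →
           ∀ (πG πH : ℕ) → IsPebblingNumber G πG → IsPebblingNumber H πH →
           ∀ (DG DH : ℕ) → IsDiam G DG → IsDiam H DH →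
           ∀ (rG : Fin m) (rH : Fin n) (c : Fin m × Fin n → ℕ) →
           ¬ Solvable (ProdAdj G H) c (rG , rH) →
           SliceBound m πG (2 * πG * πH) H DH (sliceG m n c) rH
           × SliceBound n πH (2 * πG * πH) G DG (sliceH m n c) rG
theorem9 {m} {n} G H _ _ πG πH (solvableG , _) (solvableH , _) DG DH _ _ rG rH c unsolvable =
  -- sliceH m n c is sliceG n m (c ∘ swap) by definition
  sliceBound H DH (sliceG m n c) rH (Product.weightedSum-< G H solvableG unsolvable) ,
  sliceBound G DG (sliceH m n c) rG (Product.weightedSum-< H G solvableH (unsolvable ∘ Solvable-swap G H))
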